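{- Let $S\subset\mathbb{Z}^2$ be a realizable set. Then there exist two non-equivalent realizations of $S$ if and only if at least one of the following conditions holds for some integers $\alpha,\beta$: (1) $\{(\alpha,\beta),(\alpha,\beta+1),(\alpha+1,\beta)\}\subset S$; (2) $\{(\alpha,\beta),(\alpha,\beta+1),(\alpha+1,\beta+1)\}\subset S$; (3) $\{(\alpha,\beta),(\alpha+1,\beta),(\alpha+1,\beta+1)\}\subset S$; (4) $\{(\alpha-1,\beta),(\alpha,\beta-1),(\alpha,\beta+1),(\alpha+1,\beta)\}\subset S$; (5) $\{(\alpha,\beta),(\alpha,\beta+2),(\alpha+1,\beta+1),(\alpha+2,\beta)\}\subset S$.
   Context: All graphs are finite, simple and connected; $d$ is the shortest-path distance. For an ordered vertex subset $W=(\omega_1,\omega_2)$ of $G$, $r(u\vert W)=(d(u,\omega_1),d(u,\omega_2))$; $W$ is a resolving set if $r(\cdot\vert W)$ is injective on $V(G)$. $(G,W)$ is a realization of $S\subset\mathbb{Z}^2$ if $W$ is a resolving set of $G$ and $S=\{r(u\vert W)\colon u\in V(G)\}$; $S$ is realizable if it has a realization. Two realizations $(G,W)$ and $(G',W')$ of $S$ are equivalent if the map $f\colon V(G)\to V(G')$ determined by $r(u\vert W)=r(f(u)\vert W')$ is a graph isomorphism. -}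

module Defs where

open import Data.Nat using (ℕ; zero; suc; _≤_)
open import Data.Bool using (Bool; true)
open import Data.Fin using (Fin)
open import Data.Integer using (ℤ; +_; _+_; _-_; 1ℤ)
open import Data.Product using (Σ; ∃; _×_; _,_)
open import Data.Sum using (_⊎_)
open import Relation.Binary.PropositionalEquality using (_≡_; _≢_)
open import Relation.Nullary using (¬_)
open import Function.Definitions using (Bijective)

record Graph (n : ℕ) : Set where
  field
    adj    : Fin n → Fin n → Bool
    sym    : ∀ u v → adj u v ≡ adj v u
    irrefl : ∀ u → adj u u ≢ true
open Graph public

Adj : ∀ {n} → Graph n → Fin n → Fin n → Set
Adj G u v = adj G u v ≡ true

data Walk {n} (G : Graph n) : Fin n → Fin n → ℕ → Set where
  here : ∀ {u} → Walk G u u zero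
  step : ∀ {u w v k} → Adj G u w → Walk G w v k → Walk G u v (suc k)

Connected : ∀ {n} → Graph n → Set
Connected {n} G = ∀ (u v : Fin n) → ∃ λ k → Walk G u v k

IsDist : ∀ {n} → Graph n → Fin n → Fin n → ℕ → Set
IsDist G u v k = Walk G u v k × (∀ m → Walk G u v m → k ≤ m)

Rep : ∀ {n} → Graph n → Fin n → Fin n → Fin n → ℤ × ℤ → Set
Rep G w₁ w₂ u p = Σ ℕ λ a → Σ ℕ λ b →
  IsDist G u w₁ a × IsDist G u w₂ b × p ≡ (+ a , + b)

Resolving : ∀ {n} → Graph n → Fin n → Fin n → Set
Resolving {n} G w₁ w₂ = ∀ (u v : Fin n) (p : ℤ × ℤ) →
  Rep G w₁ w₂ u p → Rep G w₁ w₂ v p → u ≡ v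

record Realization (S : ℤ × ℤ → Set) : Set₁ where
  field
    n         : ℕ
    G         : Graph n
    connected : Connected G
    w₁ w₂     : Fin n
    distinct  : w₁ ≢ w₂
    resolving : Resolving G w₁ w₂
    image→    : ∀ u → Σ (ℤ × ℤ) λ p → Rep G w₁ w₂ u p × S p
    image←    : ∀ p → S p → Σ (Fin n) λ u → Rep G w₁ w₂ u p
open Realization

Realizable : (ℤ × ℤ → Set) → Set₁
Realizable S = Realization S

Equivalent : ∀ {S} → Realization S → Realization S → Set
Equivalent R R' =
  Σ (Fin (n R) → Fin (n R')) λ f →
    (∀ u p → Rep (G R) (w₁ R) (w₂ R) u p → Rep (G R') (w₁ R') (w₂ R') (f u) p)
    × Bijective _≡_ _≡_ f
    × (∀ u v → (Adj (G R) u v → Adj (G R') (f u) (f v))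
               × (Adj (G R') (f u) (f v) → Adj (G R) u v))

TwoNonEquivalent : (ℤ × ℤ → Set) → Set₁
TwoNonEquivalent S = Σ (Realization S) λ R → Σ (Realization S) λ R' → ¬ Equivalent R R'

Cond : (ℤ × ℤ → Set) → ℤ → ℤ → Set
Cond S α β =
     (S (α , β) × S (α , β + 1ℤ) × S (α + 1ℤ , β))
  ⊎ (S (α , β) × S (α , β + 1ℤ) × S (α + 1ℤ , β + 1ℤ))
  ⊎ (S (α , β) × S (α + 1ℤ , β) × S (α + 1ℤ , β + 1ℤ))
  ⊎ (S (α - 1ℤ , β) × S (α , β - 1ℤ) × S (α , β + 1ℤ) × S (α + 1ℤ , β))
  ⊎ (S (α , β) × S (α , β + + 2) × S (α + 1ℤ , β + 1ℤ) × S (α + + 2 , β))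

-- Identify each vertex with its representation r(u | W) ∈ ℕ². Distances to a landmark change
-- by at most one along an edge, so every edge joins king-adjacent points (Chebyshev distance
-- one), and every vertex other than a landmark has a neighbour one step closer to it.
-- Conversely, any graph on the labelled vertices with these two properties realizes S with the
-- same representations. Hence all realizations joining every king-adjacent pair are
-- equivalent, and two non-equivalent ones exist iff some king edge can be omitted without
-- destroying these descents. Chasing descents from the ends of an omitted king edge always
-- produces one of the five configurations; conversely, each configuration contains a king
-- edge whose descents can be rerouted through a third point of S.
module Submission where

open import Defs hiding (sym)
open import Data.Bool using (true)
import Data.Bool.Properties as Bool
open import Data.Empty using (⊥; ⊥-elim)
open import Data.Fin using (Fin)
import Data.Fin.Properties as Fin
open import Data.Integer using (ℤ; +_; 1ℤ) renaming (_+_ to _+ℤ_; _-_ to _-ℤ_)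
import Data.Integer.Properties as ℤ
open import Data.Nat using (ℕ; zero; suc; _+_; _≤_; s≤s)
import Data.Nat.Properties as ℕ
open import Data.Product using (∃; ∃₂; _×_; _,_; proj₁; proj₂; curry)
import Data.Product.Properties as Product
open import Data.Sum using (_⊎_; inj₁; inj₂)
open import Function using (_∘_)
open import Relation.Binary.Definitions using (Decidable; DecidableEquality; Symmetric)
open import Relation.Binary.PropositionalEquality
  using (_≡_; _≢_; refl; sym; trans; cong; cong₂; subst; subst₂)
open import Relation.Nullary using (¬_; yes; no; does; _×-dec_; _⊎-dec_; ¬?)
open import Relation.Nullary.Decidable using (dec-true; dec-false; decidable-stable)

-- Points of ℕ² and the king relation

data Near : ℕ → ℕ → Set where
  equal : ∀ {a} → Near a a
  above : ∀ {a} → Near a (suc a)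
  below : ∀ {a} → Near (suc a) a

near-sym : ∀ {a c} → Near a c → Near c a
near-sym equal = equal
near-sym above = below
near-sym below = above

near-suc : ∀ {a c} → Near a c → Near (suc a) (suc c)
near-suc equal = equal
near-suc above = above
near-suc below = below

near⇒≤ : ∀ {a c} → Near a c → a ≤ suc c
near⇒≤ {a} equal = ℕ.n≤1+n a
near⇒≤ {a} above = ℕ.m≤n⇒m≤1+n (ℕ.n≤1+n a)
near⇒≤ below = ℕ.≤-refl

≤⇒near : ∀ {a c} → a ≤ suc c → c ≤ suc a → Near a c
≤⇒near {zero}        {zero}        _       _       = equal
≤⇒near {zero}        {suc zero}    _       _       = above
≤⇒near {zero}        {suc (suc c)} _       (s≤s ())
≤⇒near {suc zero}    {zero}        _       _       = below
≤⇒near {suc (suc a)} {zero}        (s≤s ()) _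
≤⇒near {suc a}       {suc c}       (s≤s p) (s≤s q) = near-suc (≤⇒near p q)

near? : Decidable Near
near? a c with a ℕ.≤? suc c | c ℕ.≤? suc a
... | yes p | yes q = yes (≤⇒near p q)
... | no ¬p | _     = no (¬p ∘ near⇒≤)
... | _     | no ¬q = no (¬q ∘ near⇒≤ ∘ near-sym)

Point : Set
Point = ℕ × ℕ

_≟_ : DecidableEquality Point
_≟_ = Product.≡-dec ℕ._≟_ ℕ._≟_

King : Point → Point → Set
King p q = Near (proj₁ p) (proj₁ q) × Near (proj₂ p) (proj₂ q) × p ≢ q

king-sym : Symmetric King
king-sym (n₁ , n₂ , p≢q) = near-sym n₁ , near-sym n₂ , p≢q ∘ sym

king? : Decidable King
king? p q = near? _ _ ×-dec near? _ _ ×-dec ¬? (p ≟ q)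

data Axis : Set where
  first second : Axis

coord : Axis → Point → ℕ
coord first  = proj₁
coord second = proj₂

king⇒near : ∀ i {p q} → King p q → Near (coord i p) (coord i q)
king⇒near first  = proj₁
king⇒near second = proj₁ ∘ proj₂

-- The five configurations of the theorem, translated so that every coordinate is a
-- natural number (condition (4) is taken at (α , β) = (a + 1 , b + 1)).
data Configuration (P : Point → Set) : Set where
  config₁ : ∀ a b → P (a , b) → P (a , suc b) → P (suc a , b) → Configuration P
  config₂ : ∀ a b → P (a , b) → P (a , suc b) → P (suc a , suc b) → Configuration P
  config₃ : ∀ a b → P (a , b) → P (suc a , b) → P (suc a , suc b) → Configuration P
  config₄ : ∀ a b → P (a , suc b) → P (suc a , b) → P (suc a , suc (suc b)) →
            P (suc (suc a) , suc b) → Configuration P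
  config₅ : ∀ a b → P (a , b) → P (a , suc (suc b)) → P (suc a , suc b) →
            P (suc (suc a) , b) → Configuration P

-- A missing king edge forces a configuration

module _ {P : Point → Set} {E : Point → Point → Set}
  (E-sym : Symmetric E)
  (E⇒P : ∀ {p q} → E p q → P q)
  (E⇒king : ∀ {p q} → E p q → King p q)
  (descend₁ : ∀ {a b} → P (suc a , b) → ∃ λ c → E (suc a , b) (a , c))
  (descend₂ : ∀ {a b} → P (a , suc b) → ∃ λ c → E (a , suc b) (c , b))
  where

  private
    -- In each case a descent from an endpoint either returns to the other endpoint,
    -- contradicting ¬ E, or supplies the missing points of a configuration.
    horizontal : ∀ {a b} → P (a , b) → P (suc a , b) → ¬ E (a , b) (suc a , b) →
                 Configuration P
    horizontal {a} {b} p∈P q∈P ¬e with descend₁ q∈P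
    ... | c , e with E⇒king e
    ...   | _ , equal , _ = ⊥-elim (¬e (E-sym e))
    ...   | _ , above , _ = config₁ a b p∈P (E⇒P e) q∈P
    ...   | _ , below , _ = config₂ a c (E⇒P e) p∈P q∈P

    vertical : ∀ {a b} → P (a , b) → P (a , suc b) → ¬ E (a , b) (a , suc b) →
               Configuration P
    vertical {a} {b} p∈P q∈P ¬e with descend₂ q∈P
    ... | c , e with E⇒king e
    ...   | equal , _ = ⊥-elim (¬e (E-sym e))
    ...   | above , _ = config₁ a b p∈P q∈P (E⇒P e)
    ...   | below , _ = config₃ c b (E⇒P e) p∈P q∈P

    diagonal : ∀ {a b} → P (a , b) → P (suc a , suc b) → ¬ E (a , b) (suc a , suc b) →
               Configuration P
    diagonal {a} {b} p∈P q∈P ¬e with descend₁ q∈P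
    ... | _ , e with E⇒king e
    ...   | _ , equal , _ = config₂ a b p∈P (E⇒P e) q∈P
    ...   | _ , below , _ = ⊥-elim (¬e (E-sym e))
    ...   | _ , above , _ with descend₂ q∈P
    ...     | _ , f with E⇒king f
    ...       | equal , _ = config₃ a b p∈P (E⇒P f) q∈P
    ...       | above , _ = config₅ a b p∈P (E⇒P e) q∈P (E⇒P f)
    ...       | below , _ = ⊥-elim (¬e (E-sym f))

    antidiagonal : ∀ {a b} → P (a , suc b) → P (suc a , b) → ¬ E (a , suc b) (suc a , b) →
                   Configuration P
    antidiagonal {a} {b} p∈P q∈P ¬e with descend₁ q∈P
    ... | c , e with E⇒king e
    ...   | _ , equal , _ = config₁ a b (E⇒P e) p∈P q∈P
    ...   | _ , above , _ = ⊥-elim (¬e (E-sym e))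
    ...   | _ , below , _ with descend₂ p∈P
    ...     | d , f with E⇒king f
    ...       | equal , _ = config₁ a (suc c) (E⇒P f) p∈P q∈P
    ...       | above , _ = ⊥-elim (¬e f)
    ...       | below , _ = config₄ d c (E⇒P f) (E⇒P e) p∈P q∈P

  king-non-edge⇒configuration : ∀ {p q} → P p → P q → King p q → ¬ E p q → Configuration P
  king-non-edge⇒configuration p∈P q∈P (equal , equal , p≢q) _ = ⊥-elim (p≢q refl)
  king-non-edge⇒configuration p∈P q∈P (equal , above , _) ¬e = vertical p∈P q∈P ¬e
  king-non-edge⇒configuration p∈P q∈P (equal , below , _) ¬e = vertical q∈P p∈P (¬e ∘ E-sym)
  king-non-edge⇒configuration p∈P q∈P (above , equal , _) ¬e = horizontal p∈P q∈P ¬e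
  king-non-edge⇒configuration p∈P q∈P (below , equal , _) ¬e = horizontal q∈P p∈P (¬e ∘ E-sym)
  king-non-edge⇒configuration p∈P q∈P (above , above , _) ¬e = diagonal p∈P q∈P ¬e
  king-non-edge⇒configuration p∈P q∈P (below , below , _) ¬e = diagonal q∈P p∈P (¬e ∘ E-sym)
  king-non-edge⇒configuration p∈P q∈P (above , below , _) ¬e = antidiagonal p∈P q∈P ¬e
  king-non-edge⇒configuration p∈P q∈P (below , above , _) ¬e = antidiagonal q∈P p∈P (¬e ∘ E-sym)

-- Configurations contain a removable king edge

Bypass : (Point → Set) → Axis → Point → Point → Set
Bypass P i p q = coord i p ≡ suc (coord i q) →
  ∃ λ r → P r × King p r × r ≢ q × coord i r ≡ coord i q

-- Every descent towards a landmark along the edge pq can be rerouted through another point.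
record RemovableEdge (P : Point → Set) : Set where
  field
    p q      : Point
    p∈P      : P p
    q∈P      : P q
    p-king-q : King p q
    bypass   : ∀ i → Bypass P i p q × Bypass P i q p

configuration⇒removableEdge : ∀ {P} → Configuration P → RemovableEdge P
configuration⇒removableEdge (config₁ a b s₀ s₁ s₂) = record
  { p∈P = s₂ ; q∈P = s₁ ; p-king-q = below , above , λ ()
  ; bypass = λ where
      first  → (λ _ → _ , s₀ , (below , equal , λ ()) , (λ ()) , refl) , λ ()
      second → (λ ()) , λ _ → _ , s₀ , (equal , below , λ ()) , (λ ()) , refl
  }
configuration⇒removableEdge (config₂ a b s₀ s₁ s₂) = record
  { p∈P = s₂ ; q∈P = s₁ ; p-king-q = below , equal , λ ()
  ; bypass = λ where
      first  → (λ _ → _ , s₀ , (below , below , λ ()) , (λ ()) , refl) , λ ()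
      second → (λ ()) , λ ()
  }
configuration⇒removableEdge (config₃ a b s₀ s₁ s₂) = record
  { p∈P = s₂ ; q∈P = s₁ ; p-king-q = equal , below , λ ()
  ; bypass = λ where
      first  → (λ ()) , λ ()
      second → (λ _ → _ , s₀ , (below , below , λ ()) , (λ ()) , refl) , λ ()
  }
configuration⇒removableEdge (config₄ a b s₀ s₁ s₂ s₃) = record
  { p∈P = s₃ ; q∈P = s₂ ; p-king-q = below , above , λ ()
  ; bypass = λ where
      first  → (λ _ → _ , s₁ , (below , below , λ ()) , (λ ()) , refl) , λ ()
      second → (λ ()) , λ _ → _ , s₀ , (below , below , λ ()) , (λ ()) , refl
  }
configuration⇒removableEdge (config₅ a b s₀ s₁ s₂ s₃) = record
  { p∈P = s₂ ; q∈P = s₀ ; p-king-q = below , below , λ ()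
  ; bypass = λ where
      first  → (λ _ → _ , s₁ , (below , above , λ ()) , (λ ()) , refl) , λ ()
      second → (λ _ → _ , s₃ , (above , below , λ ()) , (λ ()) , refl) , λ ()
  }

Edge : Point → Point → Point → Point → Set
Edge p₀ q₀ p q = (p ≡ p₀ × q ≡ q₀) ⊎ (p ≡ q₀ × q ≡ p₀)

edge? : ∀ p₀ q₀ → Decidable (Edge p₀ q₀)
edge? p₀ q₀ p q = ((p ≟ p₀) ×-dec (q ≟ q₀)) ⊎-dec ((p ≟ q₀) ×-dec (q ≟ p₀))

edge-sym : ∀ {p₀ q₀} → Symmetric (Edge p₀ q₀)
edge-sym (inj₁ (p≡p₀ , q≡q₀)) = inj₂ (q≡q₀ , p≡p₀)
edge-sym (inj₂ (p≡q₀ , q≡p₀)) = inj₁ (q≡p₀ , p≡q₀)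

module _ {P : Point → Set} (e : RemovableEdge P) where
  open RemovableEdge e

  bypass-avoiding-edge : ∀ i {p′ q′} → Edge p q p′ q′ → coord i p′ ≡ suc (coord i q′) →
    ∃ λ r → P r × King p′ r × ¬ Edge p q p′ r × coord i r ≡ coord i q′
  bypass-avoiding-edge i (inj₁ (refl , refl)) d with proj₁ (bypass i) d
  ... | r , r∈P , k , r≢q , e′ = r , r∈P , k , avoid , e′
    where
    avoid : ¬ Edge p q p r
    avoid (inj₁ (_ , r≡q)) = r≢q r≡q
    avoid (inj₂ (p≡q , _)) = proj₂ (proj₂ p-king-q) p≡q
  bypass-avoiding-edge i (inj₂ (refl , refl)) d with proj₂ (bypass i) d
  ... | r , r∈P , k , r≢p , e′ = r , r∈P , k , avoid , e′
    where
    avoid : ¬ Edge p q q r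
    avoid (inj₁ (q≡p , _)) = proj₂ (proj₂ p-king-q) (sym q≡p)
    avoid (inj₂ (_ , r≡p)) = r≢p r≡p

embed : Point → ℤ × ℤ
embed p = + proj₁ p , + proj₂ p

embed-injective : ∀ {p q} → embed p ≡ embed q → p ≡ q
embed-injective {_ , _} {_ , _} refl = refl

+-1ℤ : ∀ n → + n +ℤ 1ℤ ≡ + suc n
+-1ℤ n = ℤ.+-comm (+ n) 1ℤ

+-2ℤ : ∀ n → + n +ℤ + 2 ≡ + suc (suc n)
+-2ℤ n = ℤ.+-comm (+ n) (+ 2)

module _ {S : ℤ × ℤ → Set} where
  private
    move : ∀ {x x′ y y′} → x ≡ x′ → y ≡ y′ → S (x , y) → S (x′ , y′)
    move = subst₂ (curry S)

  configuration⇒cond : Configuration (S ∘ embed) → ∃₂ λ α β → Cond S α β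
  configuration⇒cond (config₁ a b s₀ s₁ s₂) =
    + a , + b , inj₁ (s₀ , move refl (sym (+-1ℤ b)) s₁ , move (sym (+-1ℤ a)) refl s₂)
  configuration⇒cond (config₂ a b s₀ s₁ s₂) =
    + a , + b , inj₂ (inj₁ (s₀ , move refl (sym (+-1ℤ b)) s₁
                          , move (sym (+-1ℤ a)) (sym (+-1ℤ b)) s₂))
  configuration⇒cond (config₃ a b s₀ s₁ s₂) =
    + a , + b , inj₂ (inj₂ (inj₁ (s₀ , move (sym (+-1ℤ a)) refl s₁
                                 , move (sym (+-1ℤ a)) (sym (+-1ℤ b)) s₂)))
  configuration⇒cond (config₄ a b s₀ s₁ s₂ s₃) =
    + suc a , + suc b , inj₂ (inj₂ (inj₂ (inj₁ (s₀ , s₁ , move refl (sym (+-1ℤ (suc b))) s₂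
                                               , move (sym (+-1ℤ (suc a))) refl s₃))))
  configuration⇒cond (config₅ a b s₀ s₁ s₂ s₃) =
    + a , + b , inj₂ (inj₂ (inj₂ (inj₂ (s₀ , move refl (sym (+-2ℤ b)) s₁
                                       , move (sym (+-1ℤ a)) (sym (+-1ℤ b)) s₂
                                       , move (sym (+-2ℤ a)) refl s₃))))

  module _ (natural : ∀ {x y} → S (x , y) → ∃₂ λ a b → x ≡ + a × y ≡ + b) where
    private
      -- Here + 0 - 1ℤ reduces to -[1+ 0 ], which is not natural, and + suc a - 1ℤ to + a.
      config₄-at : ∀ a b → S (+ a -ℤ 1ℤ , + b) → S (+ a , + b -ℤ 1ℤ) → S (+ a , + b +ℤ 1ℤ) →
                   S (+ a +ℤ 1ℤ , + b) → Configuration (S ∘ embed)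
      config₄-at zero b s₀ _ _ _ with natural s₀
      ... | _ , _ , () , _
      config₄-at (suc a) zero _ s₁ _ _ with natural s₁
      ... | _ , _ , _ , ()
      config₄-at (suc a) (suc b) s₀ s₁ s₂ s₃ =
        config₄ a b s₀ s₁ (move refl (+-1ℤ (suc b)) s₂) (move (+-1ℤ (suc a)) refl s₃)

    cond⇒configuration : ∀ {α β} → Cond S α β → Configuration (S ∘ embed)
    cond⇒configuration (inj₁ (s₀ , s₁ , s₂)) with natural s₀
    ... | a , b , refl , refl = config₁ a b s₀ (move refl (+-1ℤ b) s₁) (move (+-1ℤ a) refl s₂)
    cond⇒configuration (inj₂ (inj₁ (s₀ , s₁ , s₂))) with natural s₀
    ... | a , b , refl , refl =
      config₂ a b s₀ (move refl (+-1ℤ b) s₁) (move (+-1ℤ a) (+-1ℤ b) s₂)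
    cond⇒configuration (inj₂ (inj₂ (inj₁ (s₀ , s₁ , s₂)))) with natural s₀
    ... | a , b , refl , refl =
      config₃ a b s₀ (move (+-1ℤ a) refl s₁) (move (+-1ℤ a) (+-1ℤ b) s₂)
    cond⇒configuration (inj₂ (inj₂ (inj₂ (inj₁ (s₀ , s₁ , s₂ , s₃))))) with natural s₂ | natural s₃
    ... | a , _ , refl , _ | _ , b , _ , refl = config₄-at a b s₀ s₁ s₂ s₃
    cond⇒configuration (inj₂ (inj₂ (inj₂ (inj₂ (s₀ , s₁ , s₂ , s₃))))) with natural s₀
    ... | a , b , refl , refl =
      config₅ a b s₀ (move refl (+-2ℤ b) s₁) (move (+-1ℤ a) (+-1ℤ b) s₂) (move (+-2ℤ a) refl s₃)

module _ {m} (H : Graph m) where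

  adj-sym : ∀ {u v} → Adj H u v → Adj H v u
  adj-sym {u} {v} = trans (Graph.sym H v u)

  walk-snoc : ∀ {u v w k} → Walk H u v k → Adj H v w → Walk H u w (suc k)
  walk-snoc here       a = step a here
  walk-snoc (step b p) a = step b (walk-snoc p a)

  walk-reverse : ∀ {u v k} → Walk H u v k → Walk H v u k
  walk-reverse here       = here
  walk-reverse (step a p) = walk-snoc (walk-reverse p) (adj-sym a)

  walk-++ : ∀ {u v w k l} → Walk H u v k → Walk H v w l → Walk H u w (k + l)
  walk-++ here       q = q
  walk-++ (step a p) q = step a (walk-++ p q)

  isDist-unique : ∀ {u v k l} → IsDist H u v k → IsDist H u v l → k ≡ l
  isDist-unique (p , min-p) (q , min-q) = ℕ.≤-antisym (min-p _ q) (min-q _ p)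

  rep-unique : ∀ {w₁ w₂ u p q} → Rep H w₁ w₂ u p → Rep H w₁ w₂ u q → p ≡ q
  rep-unique (_ , _ , d₁ , d₂ , refl) (_ , _ , d₁′ , d₂′ , refl) =
    cong₂ (λ a b → + a , + b) (isDist-unique d₁ d₁′) (isDist-unique d₂ d₂′)

  module Distance (w : Fin m) (L : Fin m → ℕ) (isDist : ∀ x → IsDist H x w (L x)) where

    dist-adj : ∀ {x y} → Adj H x y → L x ≤ suc (L y)
    dist-adj {x} {y} a = proj₂ (isDist x) _ (step a (proj₁ (isDist y)))

    dist-self : L w ≡ 0
    dist-self = ℕ.n≤0⇒n≡0 (proj₂ (isDist w) 0 here)

    dist≡0⇒≡ : ∀ {x} → L x ≡ 0 → x ≡ w
    dist≡0⇒≡ {x} e = walk₀ (subst (Walk H x w) e (proj₁ (isDist x)))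
      where
      walk₀ : ∀ {x} → Walk H x w 0 → x ≡ w
      walk₀ here = refl

    dist-descent : ∀ {x k} → L x ≡ suc k → ∃ λ y → Adj H x y × L y ≡ k
    dist-descent {x} e with subst (Walk H x w) e (proj₁ (isDist x))
    ... | step {w = y} a p = y , a , ℕ.≤-antisym (proj₂ (isDist y) _ p)
                                                 (ℕ.≤-pred (subst (_≤ suc (L y)) e (dist-adj a)))

  isDist-by-descent : (w : Fin m) (L : Fin m → ℕ) →
    L w ≡ 0 → (∀ {x} → L x ≡ 0 → x ≡ w) →
    (∀ {x y} → Adj H x y → L x ≤ suc (L y)) →
    (∀ {x k} → L x ≡ suc k → ∃ λ y → Adj H x y × L y ≡ k) →
    ∀ x → IsDist H x w (L x)
  isDist-by-descent w L Lw≡0 L≡0⇒≡ L-adj L-descent x = walk (L x) refl , lower-bound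
    where
    walk : ∀ {x} k → L x ≡ k → Walk H x w k
    walk zero    e = subst (λ x → Walk H x w 0) (sym (L≡0⇒≡ e)) here
    walk (suc k) e with L-descent e
    ... | y , a , e′ = step a (walk k e′)

    lower-bound : ∀ {x} k → Walk H x w k → L x ≤ k
    lower-bound _ here       = ℕ.≤-reflexive Lw≡0
    lower-bound _ (step a p) = ℕ.≤-trans (L-adj a) (s≤s (lower-bound _ p))

module DecidableGraph {m} (R : Fin m → Fin m → Set) (R? : Decidable R) (R-sym : Symmetric R)
                     (R-irrefl : ∀ {x} → ¬ R x x) where

  adj⇒rel : ∀ {x y} → does (R? x y) ≡ true → R x y
  adj⇒rel {x} {y} e with R? x y
  ... | yes r = r
  ... | no _  with () ← e

  rel⇒adj : ∀ {x y} → R x y → does (R? x y) ≡ true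
  rel⇒adj {x} {y} = dec-true (R? x y)

  graph : Graph m
  graph = record
    { adj    = λ x y → does (R? x y)
    ; sym    = does-sym
    ; irrefl = λ x → R-irrefl ∘ adj⇒rel
    }
    where
    does-sym : ∀ x y → does (R? x y) ≡ does (R? y x)
    does-sym x y with R? x y
    ... | yes r = sym (dec-true (R? y x) (R-sym r))
    ... | no ¬r = sym (dec-false (R? y x) (¬r ∘ R-sym))

-- The vertices of a realization as points of ℕ²

module Labelling {S : ℤ × ℤ → Set} (R : Realization S) where
  open Realization R

  private
    rep : ∀ u → Rep G w₁ w₂ u (proj₁ (image→ u))
    rep u = proj₁ (proj₂ (image→ u))

  lab : Fin n → Point
  lab u = proj₁ (rep u) , proj₁ (proj₂ (rep u))

  landmark : Axis → Fin n
  landmark first  = w₁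
  landmark second = w₂

  dist : ∀ i u → IsDist G u (landmark i) (coord i (lab u))
  dist first  u = proj₁ (proj₂ (proj₂ (rep u)))
  dist second u = proj₁ (proj₂ (proj₂ (proj₂ (rep u))))

  module D (i : Axis) = Distance G (landmark i) (coord i ∘ lab) (dist i)

  rep-lab : ∀ u → Rep G w₁ w₂ u (embed (lab u))
  rep-lab u = _ , _ , dist first u , dist second u , refl

  lab∈S : ∀ u → S (embed (lab u))
  lab∈S u = subst S (proj₂ (proj₂ (proj₂ (proj₂ (rep u))))) (proj₂ (proj₂ (image→ u)))

  lab-injective : ∀ {x y} → lab x ≡ lab y → x ≡ y
  lab-injective {x} {y} e =
    resolving x y _ (rep-lab x) (subst (Rep G w₁ w₂ y ∘ embed) (sym e) (rep-lab y))

  vertex-at : ∀ {p} → S (embed p) → ∃ λ x → lab x ≡ p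
  vertex-at s with image← _ s
  ... | x , r = x , embed-injective (rep-unique G (rep-lab x) r)

  natural : ∀ {x y} → S (x , y) → ∃₂ λ a b → x ≡ + a × y ≡ + b
  natural s with image← _ s
  ... | _ , a , b , _ , _ , refl = a , b , refl , refl

  adjacent⇒king : ∀ {x y} → Adj G x y → King (lab x) (lab y)
  adjacent⇒king {x} a = near first , near second , x≢y ∘ lab-injective
    where
    near : ∀ i → Near _ _
    near i = ≤⇒near (D.dist-adj i a) (D.dist-adj i (adj-sym G a))
    x≢y : x ≢ _
    x≢y refl = Graph.irrefl G x a

  module _ (H : Graph n) (H⇒king : ∀ {x y} → Adj H x y → King (lab x) (lab y))
           (H-descent : ∀ i {x k} → coord i (lab x) ≡ suc k →
                        ∃ λ y → Adj H x y × coord i (lab y) ≡ k) where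
    private
      distH : ∀ i x → IsDist H x (landmark i) (coord i (lab x))
      distH i = isDist-by-descent H (landmark i) (coord i ∘ lab) (D.dist-self i)
                  (D.dist≡0⇒≡ i) (near⇒≤ ∘ king⇒near i ∘ H⇒king) (H-descent i)

      repH : ∀ x → Rep H w₁ w₂ x (embed (lab x))
      repH x = _ , _ , distH first x , distH second x , refl

    realizationOn : Realization S
    realizationOn = record
      { n         = n
      ; G         = H
      ; connected = λ u v → _ , walk-++ H (proj₁ (distH first u))
                                          (walk-reverse H (proj₁ (distH first v)))
      ; w₁        = w₁
      ; w₂        = w₂
      ; distinct  = distinct
      ; resolving = λ u v p r r′ → lab-injective (embed-injective
          (trans (rep-unique H (repH u) r) (rep-unique H r′ (repH v))))
      ; image→    = λ u → embed (lab u) , repH u , lab∈S u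
      ; image←    = λ p s → let (x , r) = image← p s in
          x , subst (Rep H w₁ w₂ x) (rep-unique G (rep-lab x) r) (repH x)
      }

  module KingGraph (F : Point → Point → Set) (F? : Decidable F) (F-sym : Symmetric F) where
    KingExcept : Fin n → Fin n → Set
    KingExcept x y = King (lab x) (lab y) × ¬ F (lab x) (lab y)

    open DecidableGraph KingExcept (λ x y → king? _ _ ×-dec ¬? (F? _ _))
      (λ (k , ¬f) → king-sym k , ¬f ∘ F-sym) (λ (k , _) → proj₂ (proj₂ k) refl) public

    descent-avoiding : (∀ i {p q} → F p q → coord i p ≡ suc (coord i q) →
                        ∃ λ r → S (embed r) × King p r × ¬ F p r × coord i r ≡ coord i q) →
                       ∀ i {x k} → coord i (lab x) ≡ suc k →
                       ∃ λ y → Adj graph x y × coord i (lab y) ≡ k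
    descent-avoiding bypass i {x} e with D.dist-descent i e
    ... | y , a , refl with F? (lab x) (lab y)
    ...   | no ¬f = y , rel⇒adj (adjacent⇒king a , ¬f) , refl
    ...   | yes f with bypass i f e
    ...     | r , r∈S , k , ¬f′ , e′ with vertex-at r∈S
    ...       | z , refl = z , rel⇒adj (k , ¬f′) , e′

  Complete : Set
  Complete = ∀ u v → King (lab u) (lab v) → Adj G u v

  incomplete⊎complete : (∃₂ λ u v → King (lab u) (lab v) × ¬ Adj G u v) ⊎ Complete
  incomplete⊎complete with Fin.any? (λ u → Fin.any? (λ v →
                             king? (lab u) (lab v) ×-dec ¬? (adj G u v Bool.≟ true)))
  ... | yes (u , v , missing) = inj₁ (u , v , missing)
  ... | no ¬missing = inj₂ λ u v k →
    decidable-stable (adj G u v Bool.≟ true) (λ ¬a → ¬missing (u , v , k , ¬a))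

  incomplete⇒configuration : ∀ {u v} → King (lab u) (lab v) → ¬ Adj G u v →
                             Configuration (S ∘ embed)
  incomplete⇒configuration {u} {v} k ¬a =
    king-non-edge⇒configuration E-sym E⇒S E⇒king descend₁ descend₂ (lab∈S u) (lab∈S v) k ¬E
    where
    E : Point → Point → Set
    E p q = ∃₂ λ x y → lab x ≡ p × lab y ≡ q × Adj G x y

    E-sym : Symmetric E
    E-sym (x , y , refl , refl , a) = y , x , refl , refl , adj-sym G a

    E⇒S : ∀ {p q} → E p q → S (embed q)
    E⇒S (_ , y , _ , refl , _) = lab∈S y

    E⇒king : ∀ {p q} → E p q → King p q
    E⇒king (_ , _ , refl , refl , a) = adjacent⇒king a

    ¬E : ¬ E (lab u) (lab v)
    ¬E (x , y , x∼u , y∼v , a) = ¬a (subst₂ (Adj G) (lab-injective x∼u) (lab-injective y∼v) a)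

    descend₁ : ∀ {a b} → S (embed (suc a , b)) → ∃ λ c → E (suc a , b) (a , c)
    descend₁ s with vertex-at s
    ... | x , x∼p with D.dist-descent first (cong proj₁ x∼p)
    ...   | y , a , refl = _ , x , y , x∼p , refl , a

    descend₂ : ∀ {a b} → S (embed (a , suc b)) → ∃ λ c → E (a , suc b) (c , b)
    descend₂ s with vertex-at s
    ... | x , x∼p with D.dist-descent second (cong proj₂ x∼p)
    ...   | y , a , refl = _ , x , y , x∼p , refl , a

module _ {S : ℤ × ℤ → Set} (R₁ R₂ : Realization S) where
  private
    module L₁ = Labelling R₁
    module L₂ = Labelling R₂
    open Realization using (n; G; w₁; w₂)

  equivalence-preserves-labels : (e : Equivalent R₁ R₂) → ∀ u → L₂.lab (proj₁ e u) ≡ L₁.lab u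
  equivalence-preserves-labels (f , f-rep , _) u =
    embed-injective (rep-unique (G R₂) (L₂.rep-lab (f u)) (f-rep u _ (L₁.rep-lab u)))

  complete⇒equivalent : L₁.Complete → L₂.Complete → Equivalent R₁ R₂
  complete⇒equivalent complete₁ complete₂ = f , f-rep , (f-injective , f-surjective) , f-adj
    where
    f : Fin (n R₁) → Fin (n R₂)
    f u = proj₁ (L₂.vertex-at (L₁.lab∈S u))

    f-lab : ∀ u → L₂.lab (f u) ≡ L₁.lab u
    f-lab u = proj₂ (L₂.vertex-at (L₁.lab∈S u))

    f-rep : ∀ u p → Rep (G R₁) (w₁ R₁) (w₂ R₁) u p → Rep (G R₂) (w₁ R₂) (w₂ R₂) (f u) p
    f-rep u p r = subst (Rep (G R₂) (w₁ R₂) (w₂ R₂) (f u))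
      (trans (cong embed (f-lab u)) (rep-unique (G R₁) (L₁.rep-lab u) r)) (L₂.rep-lab (f u))

    f-injective : ∀ {x y} → f x ≡ f y → x ≡ y
    f-injective {x} {y} e =
      L₁.lab-injective (trans (sym (f-lab x)) (trans (cong L₂.lab e) (f-lab y)))

    f-surjective : ∀ y → ∃ λ x → ∀ {z} → z ≡ x → f z ≡ y
    f-surjective y with L₁.vertex-at (L₂.lab∈S y)
    ... | x , x∼y = x , λ { refl → L₂.lab-injective (trans (f-lab x) x∼y) }

    f-adj : ∀ u v → (Adj (G R₁) u v → Adj (G R₂) (f u) (f v))
                  × (Adj (G R₂) (f u) (f v) → Adj (G R₁) u v)
    f-adj u v = (λ a → complete₂ (f u) (f v) (relabel₂ (L₁.adjacent⇒king a)))
              , (λ a → complete₁ u v (subst₂ King (f-lab u) (f-lab v) (L₂.adjacent⇒king a)))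
      where
      relabel₂ : King (L₁.lab u) (L₁.lab v) → King (L₂.lab (f u)) (L₂.lab (f v))
      relabel₂ = subst₂ King (sym (f-lab u)) (sym (f-lab v))

-- An equivalence between these two realizations would fix every vertex, hence the edge pq.
removableEdge⇒twoNonEquivalent : ∀ {S} → Realization S → RemovableEdge (S ∘ embed) →
                                 TwoNonEquivalent S
removableEdge⇒twoNonEquivalent {S} R e = full , pruned , full≉pruned
  where
  open Labelling R
  open RemovableEdge e
  module Full   = KingGraph (λ _ _ → ⊥) (λ _ _ → no λ ()) (λ ())
  module Pruned = KingGraph (Edge p q) (edge? p q) edge-sym

  full pruned : Realization S
  full   = realizationOn Full.graph (proj₁ ∘ Full.adj⇒rel) (Full.descent-avoiding λ _ ())
  pruned = realizationOn Pruned.graph (proj₁ ∘ Pruned.adj⇒rel)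
                         (Pruned.descent-avoiding (bypass-avoiding-edge e))

  full≉pruned : ¬ Equivalent full pruned
  full≉pruned equiv@(f , _ , _ , f-adj) with vertex-at p∈P | vertex-at q∈P
  ... | u , refl | v , refl = proj₂ (Pruned.adj⇒rel uv) (inj₁ (refl , refl))
    where
    fixed : ∀ x → f x ≡ x
    fixed x = lab-injective (equivalence-preserves-labels full pruned equiv x)

    uv : Adj Pruned.graph u v
    uv = subst₂ (Adj Pruned.graph) (fixed u) (fixed v)
                (proj₁ (f-adj u v) (Full.rel⇒adj (p-king-q , λ ())))

theorem13 : (S : ℤ × ℤ → Set) → Realizable S →
    (TwoNonEquivalent S → ∃₂ λ α β → Cond S α β)
    × ((∃₂ λ α β → Cond S α β) → TwoNonEquivalent S)
theorem13 S R = only-if , if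
  where
  module L = Labelling
  only-if : TwoNonEquivalent S → ∃₂ λ α β → Cond S α β
  only-if (R₁ , R₂ , R₁≉R₂) with L.incomplete⊎complete R₁ | L.incomplete⊎complete R₂
  ... | inj₁ (_ , _ , k , ¬a) | _ = configuration⇒cond (L.incomplete⇒configuration R₁ k ¬a)
  ... | inj₂ _ | inj₁ (_ , _ , k , ¬a) = configuration⇒cond (L.incomplete⇒configuration R₂ k ¬a)
  ... | inj₂ complete₁ | inj₂ complete₂ =
    ⊥-elim (R₁≉R₂ (complete⇒equivalent R₁ R₂ complete₁ complete₂))

  if : (∃₂ λ α β → Cond S α β) → TwoNonEquivalent S
  if (_ , _ , c) = removableEdge⇒twoNonEquivalent R
    (configuration⇒removableEdge (cond⇒configuration (L.natural R) c))
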